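{- Let $p\ge 5$ be a prime. Let $a$ and $n$ be positive integers such that $\gcd(a,p)=1$. For any integer $k$ with $0\le k\le ap^n$: if $k$ is odd, then $v_p\big(s_{p^n}(ap^n,ap^n-k)\big)\ge n$; and if $k$ is even, then $s_{p^n}(ap^n,ap^n-k)\equiv s(ap^n,ap^n-k)\pmod{p^{2n}}$.
   Context: For nonnegative integers $n,k$, the (unsigned) Stirling numbers of the first kind $s(n,k)$ are defined by $x(x+1)\cdots(x+n-1)=\sum_{k=0}^n s(n,k)x^k$. For a nonnegative integer $m$, the $m$-th Stirling numbers of the first kind $s_m(n,k)$ are defined by $(x+m)(x+m+1)\cdots(x+m+n-1)=\sum_{k=0}^n s_m(n,k)x^k$. $v_p$ denotes the $p$-adic valuation. -}

module Defs where

open import Data.Nat using (ℕ; zero; suc; _+_; _*_)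

-- Coefficients of the polynomial (x+m)(x+m+1)...(x+m+n-1):
-- stirlingM m n k = s_m(n,k), the coefficient of x^k.
-- Recurrence: P_{n+1}(x) = P_n(x) * (x + (m + n)), so
--   [x^k] P_{n+1} = [x^{k-1}] P_n + (m+n) * [x^k] P_n.
stirlingM : ℕ → ℕ → ℕ → ℕ
stirlingM m zero zero = 1
stirlingM m zero (suc k) = 0
stirlingM m (suc n) zero = (m + n) * stirlingM m n zero
stirlingM m (suc n) (suc k) = stirlingM m n k + (m + n) * stirlingM m n (suc k)

stirling1 : ℕ → ℕ → ℕ
stirling1 n k = stirlingM 0 n k

module Submission where

-- Write P_m^N(x) = (x+m)(x+m+1)...(x+m+N-1), so that stirlingM m N j is
-- the coefficient of x^j in P_m^N, and put q = p^n, N = a q.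
--
-- (1) Shift expansion.  P_q^N(x) = P_0^N(x+q) = P_0^N(x) + q P_0^N'(x)
--     + q²(...), i.e.  s_q(N,j) = s(N,j) + q ((j+1) s(N,j+1) + q e).
-- (2) Reflection.  If m + m' + N ≡ 1 (mod q), the factors of P_m^N are,
--     modulo q, the negatives of those of P_{m'}^N(-x) in reverse order,
--     so s_m(N,j) ≡ (-1)^(N+j) s_{m'}(N,j) (mod q).
-- (3) x P_1^N(x) = (x+N) P_0^N(x), i.e. s_1(N,j) = s(N,j) + N s(N,j+1).
-- For q odd and q ∣ N, (2) with m = 1, m' = 0 and (3) give
-- 2 s(N,j) ≡ 0, hence q ∣ s(N,j), whenever N + j is odd.
-- With j = N - k we have N + j ≡ k (mod 2): for k odd q ∣ s(N,j) and (1)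
-- gives q ∣ s_q(N,j); for k even q ∣ s(N,j+1) and (1) gives
-- s_q(N,j) ≡ s(N,j) (mod q²).

open import Defs
open import Data.Nat using (ℕ; zero; suc; _+_; _*_; _∸_; _^_; _≤_; _%_; _/_; s≤s; z≤n)
open import Data.Nat.Properties using (+-suc; +-identityʳ; +-assoc; m∸n+n≡m; ≤-trans; ^-distribˡ-+-*)
open import Data.Nat.Divisibility using (_∣_; _∤_; ∣-refl; ∣-trans; n∣m*n; m∣m*n; ∣m∣n⇒∣m+n; *-monoʳ-∣; >⇒∤)
open import Data.Nat.DivMod using (m≡m%n+[m/n]*n)
open import Data.Nat.Primality using (Prime; euclidsLemma; prime[2]; prime⇒irreducible)
open import Data.Nat.Coprimality using (Coprime; coprime-divisor; prime⇒coprime)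
open import Data.Nat.GCD using (gcd)
open import Data.Nat.Tactic.RingSolver using (solve-∀)
open import Data.Integer using (ℤ; +_; -_; _-_; 1ℤ; -1ℤ)
import Data.Integer as ℤ
import Data.Integer.Properties as ℤP
import Data.Integer.Tactic.RingSolver as ℤR
open import Data.Integer.Divisibility using () renaming (_∣_ to _∣ℤ_)
open import Data.Integer.Divisibility.Signed as Signed using (∣ᵤ⇒∣; ∣⇒∣ᵤ)
open import Data.Product using (_×_; _,_; ∃-syntax)
open import Data.Sum using (inj₁; inj₂)
open import Relation.Nullary using (contradiction)
open import Relation.Binary.PropositionalEquality using (_≡_; refl; sym; trans; cong; cong₂; subst; module ≡-Reasoning)
open ≡-Reasoning

-- Congruence of integers modulo a natural number.  It is a record so
-- that both sides stay visible to unification.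
infix 4 _≡_mod_
record _≡_mod_ (x y : ℤ) (q : ℕ) : Set where
  constructor congruent
  field divides-difference : + q Signed.∣ x - y
open _≡_mod_ using (divides-difference)

mod-refl : ∀ {q} x → x ≡ x mod q
mod-refl {q} x = congruent (Signed.divides (+ 0) (trans (ℤP.+-inverseʳ x) (sym (ℤP.*-zeroˡ (+ q)))))

mod-resp : ∀ {q x x′ y y′} → x ≡ x′ → y ≡ y′ → x ≡ y mod q → x′ ≡ y′ mod q
mod-resp refl refl h = h

mod-by-difference : ∀ {q x y x′ y′} → x - y ≡ x′ - y′ → x ≡ y mod q → x′ ≡ y′ mod q
mod-by-difference {q} eq (congruent h) = congruent (subst (+ q Signed.∣_) eq h)

mod-+ : ∀ {q x x′ y y′} → x ≡ x′ mod q → y ≡ y′ mod q → x ℤ.+ y ≡ x′ ℤ.+ y′ mod q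
mod-+ {q} {x} {x′} {y} {y′} (congruent hx) (congruent hy) =
  congruent (subst (+ q Signed.∣_) (rearrange x x′ y y′) (Signed.∣m∣n⇒∣m+n hx hy))
  where
  rearrange : ∀ x x′ y y′ → (x - x′) ℤ.+ (y - y′) ≡ (x ℤ.+ y) - (x′ ℤ.+ y′)
  rearrange = ℤR.solve-∀

mod-* : ∀ {q x x′ y y′} → x ≡ x′ mod q → y ≡ y′ mod q → x ℤ.* y ≡ x′ ℤ.* y′ mod q
mod-* {q} {x} {x′} {y} {y′} (congruent hx) (congruent hy) =
  congruent (subst (+ q Signed.∣_) (rearrange x x′ y y′)
    (Signed.∣m∣n⇒∣m+n (Signed.∣m⇒∣m*n y hx) (Signed.∣n⇒∣m*n x′ hy)))
  where
  rearrange : ∀ x x′ y y′ → (x - x′) ℤ.* y ℤ.+ x′ ℤ.* (y - y′) ≡ x ℤ.* y - x′ ℤ.* y′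
  rearrange = ℤR.solve-∀

pos-difference : ∀ m n → + (m + n) - + m ≡ + n
pos-difference m n = trans (cong (_- + m) (ℤP.pos-+ m n)) (cancel (+ m) (+ n))
  where
  cancel : ∀ a b → (a ℤ.+ b) - a ≡ b
  cancel = ℤR.solve-∀

mod-add-multiple : ∀ {q} m {n} → q ∣ n → + (m + n) ≡ + m mod q
mod-add-multiple {q} m {n} q∣n = congruent (subst (+ q Signed.∣_) (sym (pos-difference m n)) (∣ᵤ⇒∣ q∣n))

sign : ℕ → ℤ
sign n = -1ℤ ℤ.^ n

sign-suc : ∀ n → sign (suc n) ≡ - sign n
sign-suc n = ℤP.-1*i≡-i (sign n)

sign-+ : ∀ m n → sign (m + n) ≡ sign m ℤ.* sign n
sign-+ = ℤP.^-distribˡ-+-* -1ℤ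

sign-double : ∀ n → sign (n + n) ≡ 1ℤ
sign-double n = begin
  sign (n + n)        ≡⟨ cong sign (double n) ⟩
  sign (2 * n)        ≡⟨ sym (ℤP.^-*-assoc -1ℤ 2 n) ⟩
  1ℤ ℤ.^ n            ≡⟨ ℤP.^-zeroˡ n ⟩
  1ℤ                  ∎
  where
  double : ∀ n → n + n ≡ 2 * n
  double = solve-∀

sign-parity : ∀ k → sign k ≡ sign (k % 2)
sign-parity k = begin
  sign k                                 ≡⟨ cong sign (m≡m%n+[m/n]*n k 2) ⟩
  sign (k % 2 + k / 2 * 2)               ≡⟨ sign-+ (k % 2) (k / 2 * 2) ⟩
  sign (k % 2) ℤ.* sign (k / 2 * 2)      ≡⟨ cong (λ e → sign (k % 2) ℤ.* sign e) (halves (k / 2)) ⟩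
  sign (k % 2) ℤ.* sign (k / 2 + k / 2)  ≡⟨ cong (sign (k % 2) ℤ.*_) (sign-double (k / 2)) ⟩
  sign (k % 2) ℤ.* 1ℤ                    ≡⟨ ℤP.*-identityʳ (sign (k % 2)) ⟩
  sign (k % 2)                           ∎
  where
  halves : ∀ h → h * 2 ≡ h + h
  halves = solve-∀

-- N + (N - k) and k have the same parity, since their sum is 2N.
sign-complement : ∀ {N k} → k ≤ N → sign (N + (N ∸ k)) ≡ sign k
sign-complement {N} {k} k≤N = begin
  sign u                             ≡⟨ sym (ℤP.*-identityʳ (sign u)) ⟩
  sign u ℤ.* 1ℤ                      ≡⟨ cong (sign u ℤ.*_) (sym (sign-double k)) ⟩
  sign u ℤ.* sign (k + k)            ≡⟨ cong (sign u ℤ.*_) (sign-+ k k) ⟩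
  sign u ℤ.* (sign k ℤ.* sign k)     ≡⟨ sym (ℤP.*-assoc (sign u) (sign k) (sign k)) ⟩
  (sign u ℤ.* sign k) ℤ.* sign k     ≡⟨ cong (ℤ._* sign k) (sym (sign-+ u k)) ⟩
  sign (u + k) ℤ.* sign k            ≡⟨ cong (λ e → sign e ℤ.* sign k) u+k≡N+N ⟩
  sign (N + N) ℤ.* sign k            ≡⟨ cong (ℤ._* sign k) (sign-double N) ⟩
  1ℤ ℤ.* sign k                      ≡⟨ ℤP.*-identityˡ (sign k) ⟩
  sign k                             ∎
  where
  u = N + (N ∸ k)
  u+k≡N+N : u + k ≡ N + N
  u+k≡N+N = trans (+-assoc N (N ∸ k) k) (cong (λ t → N + t) (m∸n+n≡m k≤N))

-- Peeling off the first factor: P_m^(N+1)(x) = (x + m) P_(m+1)^N(x).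
peel-zero : ∀ m N → stirlingM m (suc N) 0 ≡ m * stirlingM (suc m) N 0
peel-zero m zero = cong (_* 1) (+-identityʳ m)
peel-zero m (suc N) = begin
  (m + suc N) * stirlingM m (suc N) 0            ≡⟨ cong ((m + suc N) *_) (peel-zero m N) ⟩
  (m + suc N) * (m * stirlingM (suc m) N 0)      ≡⟨ reorder m N (stirlingM (suc m) N 0) ⟩
  m * ((suc m + N) * stirlingM (suc m) N 0)      ∎
  where
  reorder : ∀ m N x → (m + suc N) * (m * x) ≡ m * ((suc m + N) * x)
  reorder = solve-∀

peel-suc : ∀ m N j →
  stirlingM m (suc N) (suc j) ≡ stirlingM (suc m) N j + m * stirlingM (suc m) N (suc j)
peel-suc m zero zero = cong (λ x → 1 + x * 0) (+-identityʳ m)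
peel-suc m zero (suc j) = cong (_* 0) (+-identityʳ m)
peel-suc m (suc N) zero = begin
  S m (suc N) 0 + (m + suc N) * S m (suc N) 1
    ≡⟨ cong₂ (λ x y → x + (m + suc N) * y) (peel-zero m N) (peel-suc m N 0) ⟩
  m * S (suc m) N 0 + (m + suc N) * (S (suc m) N 0 + m * S (suc m) N 1)
    ≡⟨ regroup m N (S (suc m) N 0) (S (suc m) N 1) ⟩
  (suc m + N) * S (suc m) N 0 + m * (S (suc m) N 0 + (suc m + N) * S (suc m) N 1) ∎
  where
  S = stirlingM
  regroup : ∀ m N x y →
    m * x + (m + suc N) * (x + m * y) ≡ (suc m + N) * x + m * (x + (suc m + N) * y)
  regroup = solve-∀
peel-suc m (suc N) (suc j) = begin
  S m (suc N) (suc j) + (m + suc N) * S m (suc N) (2 + j)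
    ≡⟨ cong₂ (λ x y → x + (m + suc N) * y) (peel-suc m N j) (peel-suc m N (suc j)) ⟩
  (S (suc m) N j + m * S (suc m) N (suc j))
    + (m + suc N) * (S (suc m) N (suc j) + m * S (suc m) N (2 + j))
    ≡⟨ regroup m N (S (suc m) N j) (S (suc m) N (suc j)) (S (suc m) N (2 + j)) ⟩
  (S (suc m) N j + (suc m + N) * S (suc m) N (suc j))
    + m * (S (suc m) N (suc j) + (suc m + N) * S (suc m) N (2 + j)) ∎
  where
  S = stirlingM
  regroup : ∀ m N x y z →
    (x + m * y) + (m + suc N) * (y + m * z) ≡ (x + (suc m + N) * y) + m * (y + (suc m + N) * z)
  regroup = solve-∀

-- Fact (3): x P_1^N(x) = (x + N) P_0^N(x).
stirlingM-one : ∀ N j → stirlingM 1 N j ≡ stirling1 N j + N * stirling1 N (suc j)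
stirlingM-one N j = sym (trans (peel-suc 0 N j) (+-identityʳ _))

-- Fact (1): the shift expansion of P_q^N(x) = P_0^N(x + q) to second order in q.
shift-expansion : ∀ q N j → ∃[ e ]
  stirlingM q N j ≡ stirling1 N j + q * (suc j * stirling1 N (suc j) + q * e)
shift-expansion q zero zero = 0 , base q
  where
  base : ∀ q → 1 ≡ 1 + q * (1 * 0 + q * 0)
  base = solve-∀
shift-expansion q zero (suc j) = 0 , base q j
  where
  base : ∀ q j → 0 ≡ 0 + q * (suc (suc j) * 0 + q * 0)
  base = solve-∀
shift-expansion q (suc N) zero with shift-expansion q N 0
... | e , eq = (q + N) * e + stirling1 N 1 , (begin
  (q + N) * stirlingM q N 0
    ≡⟨ cong ((q + N) *_) eq ⟩
  (q + N) * (s 0 + q * (1 * s 1 + q * e))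
    ≡⟨ expand q N (s 0) (s 1) e ⟩
  N * s 0 + q * (1 * (s 0 + N * s 1) + q * ((q + N) * e + s 1)) ∎)
  where
  s = stirling1 N
  expand : ∀ q N a b e →
    (q + N) * (a + q * (1 * b + q * e)) ≡ N * a + q * (1 * (a + N * b) + q * ((q + N) * e + b))
  expand = solve-∀
shift-expansion q (suc N) (suc j) with shift-expansion q N j | shift-expansion q N (suc j)
... | e₁ , eq₁ | e₂ , eq₂ = e₁ + (q + N) * e₂ + (2 + j) * stirling1 N (2 + j) , (begin
  stirlingM q N j + (q + N) * stirlingM q N (suc j)
    ≡⟨ cong₂ (λ x y → x + (q + N) * y) eq₁ eq₂ ⟩
  (s j + q * (suc j * s (suc j) + q * e₁))
    + (q + N) * (s (suc j) + q * ((2 + j) * s (2 + j) + q * e₂))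
    ≡⟨ expand q N j (s j) (s (suc j)) (s (2 + j)) e₁ e₂ ⟩
  (s j + N * s (suc j))
    + q * ((2 + j) * (s (suc j) + N * s (2 + j)) + q * (e₁ + (q + N) * e₂ + (2 + j) * s (2 + j))) ∎)
  where
  s = stirling1 N
  expand : ∀ q N j a b c e₁ e₂ →
    (a + q * (suc j * b + q * e₁)) + (q + N) * (b + q * ((2 + j) * c + q * e₂))
      ≡ (a + N * b) + q * ((2 + j) * (b + N * c) + q * (e₁ + (q + N) * e₂ + (2 + j) * c))
  expand = solve-∀

-- Induction step of the reflection hypothesis: passing from P_m^(N+1)
-- and P_(m')^(N+1) to P_m^N and P_(m'+1)^N preserves m + m' + N.
reflection-hyp : ∀ {q} m m′ N →
  + (m + m′ + suc N) ≡ 1ℤ mod q → + (m + suc m′ + N) ≡ 1ℤ mod q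
reflection-hyp {q} m m′ N = subst (λ t → + t ≡ 1ℤ mod q) (move m m′ N)
  where
  move : ∀ m m′ N → m + m′ + suc N ≡ m + suc m′ + N
  move = solve-∀

-- Under the reflection hypothesis the last factor x + m + N of P_m^(N+1)
-- is congruent to -(-x + m'), the reflected first factor of P_(m')^(N+1).
opposite-factor : ∀ {q} m m′ N →
  + (m + m′ + suc N) ≡ 1ℤ mod q → + (m + N) ≡ - + m′ mod q
opposite-factor m m′ N = mod-by-difference (begin
  + (m + m′ + suc N) - 1ℤ                 ≡⟨ cong (_- 1ℤ) (cong +_ (move m m′ N)) ⟩
  + (1 + (m + N + m′)) - 1ℤ               ≡⟨ cong (_- 1ℤ) (ℤP.pos-+ 1 (m + N + m′)) ⟩
  (1ℤ ℤ.+ + (m + N + m′)) - 1ℤ            ≡⟨ cong (λ t → (1ℤ ℤ.+ t) - 1ℤ) (ℤP.pos-+ (m + N) m′) ⟩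
  (1ℤ ℤ.+ (+ (m + N) ℤ.+ + m′)) - 1ℤ      ≡⟨ cancel 1ℤ (+ (m + N)) (+ m′) ⟩
  + (m + N) - - + m′                      ∎)
  where
  move : ∀ m m′ N → m + m′ + suc N ≡ 1 + (m + N + m′)
  move = solve-∀
  cancel : ∀ o a b → (o ℤ.+ (a ℤ.+ b)) - o ≡ a - - b
  cancel = ℤR.solve-∀

reflection : ∀ q m m′ N j → + (m + m′ + N) ≡ 1ℤ mod q →
  + stirlingM m N j ≡ sign (N + j) ℤ.* + stirlingM m′ N j mod q
reflection q m m′ zero zero h = mod-refl (+ 1)
reflection q m m′ zero (suc j) h = mod-resp refl (sym (ℤP.*-zeroʳ (sign (suc j)))) (mod-refl (+ 0))
reflection q m m′ (suc N) zero h =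
  mod-resp (sym (ℤP.pos-* (m + N) (S m N 0))) mirror
    (mod-* (opposite-factor m m′ N h) (reflection q m (suc m′) N 0 h′))
  where
  S = stirlingM
  h′ = reflection-hyp m m′ N h
  σ = sign (N + 0)
  regroup : ∀ σ m′ a → (- m′) ℤ.* (σ ℤ.* a) ≡ (- σ) ℤ.* (m′ ℤ.* a)
  regroup = ℤR.solve-∀
  mirror : (- + m′) ℤ.* (σ ℤ.* + S (suc m′) N 0) ≡ sign (suc N + 0) ℤ.* + S m′ (suc N) 0
  mirror = begin
    (- + m′) ℤ.* (σ ℤ.* + S (suc m′) N 0)     ≡⟨ regroup σ (+ m′) (+ S (suc m′) N 0) ⟩
    (- σ) ℤ.* (+ m′ ℤ.* + S (suc m′) N 0)     ≡⟨ cong₂ ℤ._*_ (sym (sign-suc (N + 0))) (sym (ℤP.pos-* m′ _)) ⟩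
    sign (suc N + 0) ℤ.* + (m′ * S (suc m′) N 0) ≡⟨ cong (λ t → sign (suc N + 0) ℤ.* + t) (sym (peel-zero m′ N)) ⟩
    sign (suc N + 0) ℤ.* + S m′ (suc N) 0     ∎
reflection q m m′ (suc N) (suc j) h =
  mod-resp expand mirror
    (mod-+ (reflection q m (suc m′) N j h′)
           (mod-* (opposite-factor m m′ N h) (reflection q m (suc m′) N (suc j) h′)))
  where
  S = stirlingM
  h′ = reflection-hyp m m′ N h
  σ = sign (N + j)
  a′ = + S (suc m′) N j
  b′ = + S (suc m′) N (suc j)
  expand : + S m N j ℤ.+ + (m + N) ℤ.* + S m N (suc j) ≡ + S m (suc N) (suc j)
  expand = sym (trans (ℤP.pos-+ (S m N j) _) (cong (λ t → + S m N j ℤ.+ t) (ℤP.pos-* (m + N) _)))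
  sign-next : sign (N + suc j) ≡ - σ
  sign-next = trans (cong sign (+-suc N j)) (sign-suc (N + j))
  sign-next-next : sign (suc N + suc j) ≡ - - σ
  sign-next-next = trans (sign-suc (N + suc j)) (cong -_ sign-next)
  regroup : ∀ σ m′ a b → σ ℤ.* a ℤ.+ (- m′) ℤ.* ((- σ) ℤ.* b) ≡ (- - σ) ℤ.* (a ℤ.+ m′ ℤ.* b)
  regroup = ℤR.solve-∀
  mirror : σ ℤ.* a′ ℤ.+ (- + m′) ℤ.* (sign (N + suc j) ℤ.* b′)
         ≡ sign (suc N + suc j) ℤ.* + S m′ (suc N) (suc j)
  mirror = begin
    σ ℤ.* a′ ℤ.+ (- + m′) ℤ.* (sign (N + suc j) ℤ.* b′)
      ≡⟨ cong (λ t → σ ℤ.* a′ ℤ.+ (- + m′) ℤ.* (t ℤ.* b′)) sign-next ⟩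
    σ ℤ.* a′ ℤ.+ (- + m′) ℤ.* ((- σ) ℤ.* b′)
      ≡⟨ regroup σ (+ m′) a′ b′ ⟩
    (- - σ) ℤ.* (a′ ℤ.+ + m′ ℤ.* b′)
      ≡⟨ cong₂ ℤ._*_ (sym sign-next-next)
           (sym (trans (ℤP.pos-+ (S (suc m′) N j) _) (cong (λ t → a′ ℤ.+ t) (ℤP.pos-* m′ _)))) ⟩
    sign (suc N + suc j) ℤ.* + (S (suc m′) N j + m′ * S (suc m′) N (suc j))
      ≡⟨ cong (λ t → sign (suc N + suc j) ℤ.* + t) (sym (peel-suc m′ N j)) ⟩
    sign (suc N + suc j) ℤ.* + S m′ (suc N) (suc j) ∎

odd-cancel : ∀ {q s} → 2 ∤ q → q ∣ 2 * s → q ∣ s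
odd-cancel {q} 2∤q = coprime-divisor coprime
  where
  coprime : Coprime q 2
  coprime (d∣q , d∣2) with prime⇒irreducible prime[2] d∣2
  ... | inj₁ d≡1 = d≡1
  ... | inj₂ refl = contradiction d∣q 2∤q

stirling1-divisible : ∀ {q N j} → 2 ∤ q → q ∣ N → sign (N + j) ≡ -1ℤ → q ∣ stirling1 N j
stirling1-divisible {q} {N} {j} 2∤q q∣N odd = odd-cancel {s = s} 2∤q q∣2s
  where
  s = stirling1 N j
  s′ = stirling1 N (suc j)
  -- s(N,j) + N s(N,j+1) = s_1(N,j) ≡ -s(N,j) (mod q).
  reflected : + (s + N * s′) ≡ -1ℤ ℤ.* + s mod q
  reflected = mod-resp (cong +_ (stirlingM-one N j)) (cong (ℤ._* + s) odd)
    (reflection q 1 0 N j (mod-add-multiple 1 q∣N))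
  difference : + (s + N * s′) - -1ℤ ℤ.* + s ≡ + (2 * s) ℤ.+ + (N * s′)
  difference = begin
    + (s + N * s′) - -1ℤ ℤ.* + s               ≡⟨ cong (_- -1ℤ ℤ.* + s) (ℤP.pos-+ s (N * s′)) ⟩
    (+ s ℤ.+ + (N * s′)) - -1ℤ ℤ.* + s         ≡⟨ regroup (+ s) (+ (N * s′)) ⟩
    (+ 2 ℤ.* + s) ℤ.+ + (N * s′)               ≡⟨ cong (ℤ._+ + (N * s′)) (sym (ℤP.pos-* 2 s)) ⟩
    + (2 * s) ℤ.+ + (N * s′)                   ∎
    where
    regroup : ∀ a b → (a ℤ.+ b) - -1ℤ ℤ.* a ≡ (+ 2 ℤ.* a) ℤ.+ b
    regroup = ℤR.solve-∀
  q∣Ns′ : + q Signed.∣ + (N * s′)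
  q∣Ns′ = ∣ᵤ⇒∣ (∣-trans q∣N (m∣m*n s′))
  q∣2s : q ∣ 2 * s
  q∣2s = ∣⇒∣ᵤ (Signed.∣m+n∣n⇒∣m {m = + (2 * s)}
    (subst (+ q Signed.∣_) difference (divides-difference reflected)) q∣Ns′)

shifted-divisible : ∀ q N j → q ∣ stirling1 N j → q ∣ stirlingM q N j
shifted-divisible q N j q∣s with shift-expansion q N j
... | e , expansion = subst (q ∣_) (sym expansion) (∣m∣n⇒∣m+n q∣s (m∣m*n _))

shifted-congruent : ∀ q N j → q ∣ stirling1 N (suc j) →
  q * q ∣ ℤ.∣ + stirlingM q N j - + stirling1 N j ∣
shifted-congruent q N j q∣s′ with shift-expansion q N j
... | e , expansion = subst (λ t → q * q ∣ ℤ.∣ t ∣) (sym difference)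
  (*-monoʳ-∣ q (∣m∣n⇒∣m+n (∣-trans q∣s′ (n∣m*n (suc j))) (m∣m*n e)))
  where
  s = stirling1 N j
  difference : + stirlingM q N j - + s ≡ + (q * (suc j * stirling1 N (suc j) + q * e))
  difference = trans (cong (λ t → + t - + s) expansion) (pos-difference s _)

two∤prime-power : ∀ {p} → Prime p → 5 ≤ p → ∀ n → 2 ∤ p ^ n
two∤prime-power pp p≥5 zero = >⇒∤ (s≤s (s≤s z≤n))
two∤prime-power {p} pp p≥5 (suc n) 2∣p^1+n with euclidsLemma p (p ^ n) prime[2] 2∣p^1+n
... | inj₁ 2∣p = contradiction (prime⇒coprime pp (≤-trans (s≤s (s≤s (s≤s z≤n))) p≥5) (2∣p , ∣-refl)) λ ()
... | inj₂ 2∣p^n = two∤prime-power pp p≥5 n 2∣p^n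

lemma2p11 : (p a n k : ℕ) → Prime p → 5 ≤ p → 1 ≤ a → 1 ≤ n → gcd a p ≡ 1 →
    k ≤ a * p ^ n →
    ((k % 2 ≡ 1 → p ^ n ∣ stirlingM (p ^ n) (a * p ^ n) (a * p ^ n ∸ k))
    × (k % 2 ≡ 0 → (+ (p ^ (2 * n))) ∣ℤ (+ stirlingM (p ^ n) (a * p ^ n) (a * p ^ n ∸ k) - + stirling1 (a * p ^ n) (a * p ^ n ∸ k))))
lemma2p11 p a n k prime-p p≥5 _ _ _ k≤N = odd-case , even-case
  where
  q = p ^ n
  N = a * q
  j = N ∸ k
  q-odd = two∤prime-power prime-p p≥5 n
  q∣N = n∣m*n a
  sign-N+j : sign (N + j) ≡ sign (k % 2)
  sign-N+j = trans (sign-complement k≤N) (sign-parity k)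
  odd-case : k % 2 ≡ 1 → q ∣ stirlingM q N j
  odd-case k-odd = shifted-divisible q N j (stirling1-divisible q-odd q∣N (trans sign-N+j (cong sign k-odd)))
  even-case : k % 2 ≡ 0 → p ^ (2 * n) ∣ ℤ.∣ + stirlingM q N j - + stirling1 N j ∣
  even-case k-even = subst (_∣ ℤ.∣ + stirlingM q N j - + stirling1 N j ∣) (sym q²)
    (shifted-congruent q N j (stirling1-divisible {j = suc j} q-odd q∣N sign-N+1+j))
    where
    sign-N+1+j : sign (N + suc j) ≡ -1ℤ
    sign-N+1+j = begin
      sign (N + suc j)  ≡⟨ cong sign (+-suc N j) ⟩
      sign (suc (N + j)) ≡⟨ sign-suc (N + j) ⟩
      - sign (N + j)     ≡⟨ cong -_ (trans sign-N+j (cong sign k-even)) ⟩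
      -1ℤ                ∎
    q² : p ^ (2 * n) ≡ q * q
    q² = trans (^-distribˡ-+-* p n (n + 0)) (cong (λ t → q * p ^ t) (+-identityʳ n))
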